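{- $\mathcal Z$ is a dcpo, i.e. every directed subset of $\mathcal Z$ has a supremum.
   Context: Let $\omega_1$ be the first uncountable ordinal and $\mathbb W=[0,\omega_1)$ the set of countable ordinals with their usual order. Let $\mathbb W^*$ be the set of finite strings of elements of $\mathbb W$, with $\varepsilon$ the empty string; for $u\in\mathbb W$, $s\in\mathbb W^*$, $u.s$ is the string obtained by putting $u$ in front of $s$; for $s,t\in\mathbb W^*$, $ts$ is the concatenation of $t$ followed by $s$; for nonempty $t$, $\min(t)$ is the least ordinal occurring in $t$. On $\mathcal Z=\mathbb W\times\mathbb W^*$ define, for $m,m',u,u'\in\mathbb W$ and $s,t\in\mathbb W^*$: $(m,u.s)<_1(m,u'.s)$ iff $u<u'$; $(m,ts)<_2(m,s)$ iff $t\neq\varepsilon$; $(m,ts)<_3(m',s)$ iff $t\ne\varepsilon$ and $\min(t)\le m'$. With $R;S$ the relational composite ($x\,R;S\,z$ iff $x\,R\,y$ and $y\,S\,z$ for some $y$), let $<\,=\,<_1\cup<_2\cup<_3\cup(<_2;<_1)\cup(<_3;<_1)$ and $\le\,=\,<\cup=$; this is a partial order and $\mathcal Z$ denotes the resulting poset. -}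

module Defs where

open import Level using (0ℓ)
open import Data.Nat using (ℕ)
open import Data.List using (List; []; _∷_; _++_)
open import Data.Product using (Σ; ∃; ∃-syntax; _×_; _,_)
open import Data.Sum using (_⊎_)
open import Relation.Nullary using (¬_)
open import Relation.Binary.PropositionalEquality using (_≡_)
open import Relation.Binary.Structures using (IsStrictTotalOrder)
open import Relation.Binary.Definitions using (tri<; tri≈; tri>)
open import Induction.WellFounded using (WellFounded)

-- An abstract copy of ω₁ = [0, ω₁): a strict well-order whose proper initial
-- segments are countable but which is itself uncountable.  Classically any
-- two such structures are order-isomorphic to the countable ordinals.
record Omega1 : Set₁ where
  field
    W   : Set
    _<_ : W → W → Set
    isSTO : IsStrictTotalOrder _≡_ _<_
    wf  : WellFounded _<_
    countableSegments : ∀ a → Σ (ℕ → W) λ f → ∀ b → b < a → ∃[ n ] f n ≡ b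
    uncountable : ∀ (f : ℕ → W) → ¬ (∀ b → ∃[ n ] f n ≡ b)

  open IsStrictTotalOrder isSTO public using (compare)

  _≤_ : W → W → Set
  a ≤ b = a < b ⊎ a ≡ b

  min2 : W → W → W
  min2 a b with compare a b
  ... | tri< _ _ _ = a
  ... | tri≈ _ _ _ = a
  ... | tri> _ _ _ = b

  minStr : W → List W → W
  minStr u []       = u
  minStr u (v ∷ vs) = min2 u (minStr v vs)

  Z : Set
  Z = W × List W

  _<₁_ : Z → Z → Set
  (m , x) <₁ (m' , y) = m ≡ m' × ∃[ u ] ∃[ u' ] ∃[ s ] (x ≡ u ∷ s × y ≡ u' ∷ s × u < u')

  -- (m, ts) <₂ (m, s) with t ≠ ε, i.e. t = v.t'
  _<₂_ : Z → Z → Set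
  (m , x) <₂ (m' , y) = m ≡ m' × ∃[ v ] ∃[ t' ] (x ≡ (v ∷ t') ++ y)

  _<₃_ : Z → Z → Set
  (m , x) <₃ (m' , y) = ∃[ v ] ∃[ t' ] (x ≡ (v ∷ t') ++ y × minStr v t' ≤ m')

  _⨾_ : (Z → Z → Set) → (Z → Z → Set) → Z → Z → Set
  (R ⨾ S) x z = ∃[ y ] (R x y × S y z)

  _<Z_ : Z → Z → Set
  x <Z y = x <₁ y ⊎ x <₂ y ⊎ x <₃ y ⊎ (_<₂_ ⨾ _<₁_) x y ⊎ (_<₃_ ⨾ _<₁_) x y

  _≤Z_ : Z → Z → Set
  x ≤Z y = x <Z y ⊎ x ≡ y

  Directed : (Z → Set) → Set
  Directed D = (∃[ x ] D x)
             × (∀ x y → D x → D y → ∃[ z ] (D z × x ≤Z z × y ≤Z z))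

  IsSupremum : (Z → Set) → Z → Set
  IsSupremum D s = (∀ x → D x → x ≤Z s)
                 × (∀ u → (∀ x → D x → x ≤Z u) → s ≤Z u)

  IsDCPO : Set₁
  IsDCPO = ∀ (D : Z → Set) → Directed D → ∃[ s ] IsSupremum D s

{-# OPTIONS --safe #-}
-- Strings never get longer going up in 𝒵, and only <₁ keeps their length.  So if
-- (m , u₀.s) has a shortest string in a directed set D, every element of D lies below
-- some (m , u.s) ∈ D; a shortest element (m , ε) is maximal, hence the supremum.
-- For U = {u | (m , u.s) ∈ D} the supremum of D is (m , (sup U).s) if U is bounded
-- in 𝕎, and (m , s) otherwise.  Leastness comes from the shape of the up-set of
-- (m , u.s): any y above it either lies above (m , s), or the heads v with
-- (m , v.s) ≤ y are exactly those below one bound b (b = u' when y = (m , u'.s),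
-- b = m' when y = (m' , s') is reached through <₃).
module Submission where

open import Defs
open import Level using (0ℓ)
open import Axiom.ExcludedMiddle using (ExcludedMiddle)
open import Data.Nat as ℕ using (ℕ; s≤s)
open import Data.Nat.Properties using (1+n≰n)
open import Data.Nat.Induction using (<-wellFounded)
open import Data.List using (List; []; _∷_; _++_; length)
open import Data.List.Properties using (++-assoc; length-++-≤ʳ)
open import Data.Product using (∃; ∃-syntax; _×_; _,_)
open import Data.Sum using (_⊎_; inj₁; inj₂)
open import Data.Empty using (⊥-elim)
open import Relation.Nullary using (¬_; yes; no)
open import Relation.Binary.Core using (Rel)
open import Relation.Binary.PropositionalEquality using (_≡_; refl; sym; cong)
open import Relation.Binary.Structures using (IsStrictTotalOrder)
open import Relation.Binary.Definitions using (tri<; tri≈; tri>)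
open import Induction.WellFounded using (WellFounded; Acc; acc)

minimal : ExcludedMiddle 0ℓ → {A : Set} {_≺_ : Rel A 0ℓ} → WellFounded _≺_ →
          (P : A → Set) → ∀ {a} → P a → ∃ λ b → P b × (∀ {c} → c ≺ b → ¬ P c)
minimal em {_≺_ = _≺_} wf P {a} pa = go (wf a) pa
  where
  go : ∀ {a} → Acc _≺_ a → P a → ∃ λ b → P b × (∀ {c} → c ≺ b → ¬ P c)
  go {a} (acc below) pa with em {∃ λ c → c ≺ a × P c}
  ... | yes (c , c≺a , pc) = go (below c≺a) pc
  ... | no ¬smaller        = a , pa , λ c≺a pc → ¬smaller (_ , c≺a , pc)

pattern via₁  p = inj₁ p
pattern via₂  p = inj₂ (inj₁ p)
pattern via₃  p = inj₂ (inj₂ (inj₁ p))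
pattern via₂₁ p = inj₂ (inj₂ (inj₂ (inj₁ p)))
pattern via₃₁ p = inj₂ (inj₂ (inj₂ (inj₂ p)))

module _ (O : Omega1) where
  open Omega1 O
  open IsStrictTotalOrder isSTO using (trans)

  <-≤-trans : ∀ {a b c} → a < b → b ≤ c → a < c
  <-≤-trans a<b (inj₁ b<c) = trans a<b b<c
  <-≤-trans a<b (inj₂ refl) = a<b

  ≮⇒≥ : ∀ {a b} → ¬ b < a → a ≤ b
  ≮⇒≥ {a} {b} b≮a with compare a b
  ... | tri< a<b _ _ = inj₁ a<b
  ... | tri≈ _ a≡b _ = inj₂ a≡b
  ... | tri> _ _ b<a = ⊥-elim (b≮a b<a)

  min2-boundˡ : ∀ {a b c} → a ≤ c → min2 a b ≤ c
  min2-boundˡ {a} {b} a≤c with compare a b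
  ... | tri< _ _ _   = a≤c
  ... | tri≈ _ _ _   = a≤c
  ... | tri> _ _ b<a = inj₁ (<-≤-trans b<a a≤c)

  min2-boundʳ : ∀ {a b c} → b ≤ c → min2 a b ≤ c
  min2-boundʳ {a} {b} b≤c with compare a b
  ... | tri< a<b _ _  = inj₁ (<-≤-trans a<b b≤c)
  ... | tri≈ _ refl _ = b≤c
  ... | tri> _ _ _    = b≤c

  min2-bound-cases : ∀ {a b c} → min2 a b ≤ c → a ≤ c ⊎ b ≤ c
  min2-bound-cases {a} {b} min≤c with compare a b
  ... | tri< _ _ _ = inj₁ min≤c
  ... | tri≈ _ _ _ = inj₁ min≤c
  ... | tri> _ _ _ = inj₂ min≤c

  minStr-boundHead : ∀ {c} v t → v ≤ c → minStr v t ≤ c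
  minStr-boundHead v []      v≤c = v≤c
  minStr-boundHead v (_ ∷ _) v≤c = min2-boundˡ v≤c

  minStr-++ : ∀ {c} v t r → minStr v t ≤ c → minStr v (t ++ r) ≤ c
  minStr-++ v []      r min≤c = minStr-boundHead v r min≤c
  minStr-++ v (w ∷ t) r min≤c with min2-bound-cases min≤c
  ... | inj₁ v≤c   = min2-boundˡ v≤c
  ... | inj₂ min≤c = min2-boundʳ (minStr-++ w t r min≤c)

  UpperBound : (W → Set) → W → Set
  UpperBound U b = ∀ {u} → U u → u ≤ b

  leastUpperBound : ∀ (em : ExcludedMiddle 0ℓ) U → ∃ (UpperBound U) →
                    ∃ λ σ → UpperBound U σ × (∀ {c} → UpperBound U c → σ ≤ c)
  leastUpperBound em U (b , bound) with minimal em wf (UpperBound U) bound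
  ... | σ , σ-bound , noSmaller = σ , σ-bound , λ c-bound → ≮⇒≥ (λ c<σ → noSmaller c<σ c-bound)

  len : Z → ℕ
  len (_ , s) = length s

  <Z⇒<₁⊎len> : ∀ {x y} → x <Z y → x <₁ y ⊎ len y ℕ.< len x
  <Z⇒<₁⊎len> (via₁ x<y) = inj₁ x<y
  <Z⇒<₁⊎len> (via₂ (refl , _ , t , refl)) = inj₂ (s≤s (length-++-≤ʳ _ {t}))
  <Z⇒<₁⊎len> (via₃ (_ , t , refl , _)) = inj₂ (s≤s (length-++-≤ʳ _ {t}))
  <Z⇒<₁⊎len> (via₂₁ (_ , (refl , _ , t , refl) , (refl , _ , _ , _ , refl , refl , _))) =
    inj₂ (s≤s (length-++-≤ʳ _ {t}))
  <Z⇒<₁⊎len> (via₃₁ (_ , (_ , t , refl , _) , (refl , _ , _ , _ , refl , refl , _))) =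
    inj₂ (s≤s (length-++-≤ʳ _ {t}))

  []-maximal : ∀ {m y} → ¬ (m , []) <Z y
  []-maximal lt with <Z⇒<₁⊎len> lt
  ... | inj₁ (_ , _ , _ , _ , () , _)
  ... | inj₂ ()

  <₁-trans : ∀ {x y z} → x <₁ y → y <₁ z → x <₁ z
  <₁-trans (refl , _ , _ , _ , refl , refl , a<b) (refl , _ , _ , _ , refl , refl , b<c) =
    refl , _ , _ , _ , refl , refl , trans a<b b<c

  <Z-<₁-trans : ∀ {x y z} → x <Z y → y <₁ z → x <Z z
  <Z-<₁-trans (via₁ x<y) y<z = via₁ (<₁-trans x<y y<z)
  <Z-<₁-trans (via₂ x<y) y<z = via₂₁ (_ , x<y , y<z)
  <Z-<₁-trans (via₃ x<y) y<z = via₃₁ (_ , x<y , y<z)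
  <Z-<₁-trans (via₂₁ (w , x<w , w<y)) y<z = via₂₁ (w , x<w , <₁-trans w<y y<z)
  <Z-<₁-trans (via₃₁ (w , x<w , w<y)) y<z = via₃₁ (w , x<w , <₁-trans w<y y<z)

  ≤Z-raiseHead : ∀ {x m u σ s} → x ≤Z (m , u ∷ s) → u ≤ σ → x ≤Z (m , σ ∷ s)
  ≤Z-raiseHead x≤ (inj₂ refl) = x≤
  ≤Z-raiseHead (inj₂ refl) (inj₁ u<σ) = inj₁ (via₁ (refl , _ , _ , _ , refl , refl , u<σ))
  ≤Z-raiseHead (inj₁ x<) (inj₁ u<σ) = inj₁ (<Z-<₁-trans x< (refl , _ , _ , _ , refl , refl , u<σ))

  <Z-dropHead : ∀ {x m u s} → x <Z (m , u ∷ s) → x <Z (m , s)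
  <Z-dropHead (via₁ (refl , a , _ , _ , refl , refl , _)) = via₂ (refl , a , [] , refl)
  <Z-dropHead {u = u} {s} (via₂ (refl , v , t , refl)) =
    via₂ (refl , v , t ++ u ∷ [] , cong (v ∷_) (sym (++-assoc t (u ∷ []) s)))
  <Z-dropHead {u = u} {s} (via₃ (v , t , refl , min≤)) =
    via₃ (v , t ++ u ∷ [] , cong (v ∷_) (sym (++-assoc t (u ∷ []) s)) , minStr-++ v t (u ∷ []) min≤)
  <Z-dropHead {s = s} (via₂₁ (_ , (refl , v , t , refl) , (refl , a , _ , _ , refl , refl , _))) =
    via₂ (refl , v , t ++ a ∷ [] , cong (v ∷_) (sym (++-assoc t (a ∷ []) s)))
  <Z-dropHead {s = s} (via₃₁ (_ , (v , t , refl , min≤) , (refl , a , _ , _ , refl , refl , _))) =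
    via₃ (v , t ++ a ∷ [] , cong (v ∷_) (sym (++-assoc t (a ∷ []) s)) , minStr-++ v t (a ∷ []) min≤)

  ≤Z-dropHead : ∀ {x m u s} → x ≤Z (m , u ∷ s) → x <Z (m , s)
  ≤Z-dropHead (inj₂ refl) = via₂ (refl , _ , [] , refl)
  ≤Z-dropHead (inj₁ x<)   = <Z-dropHead x<

  cons-<Z : ∀ {m s v y} → (m , s) ≤Z y → (m , v ∷ s) <Z y
  cons-<Z (inj₂ refl) = via₂ (refl , _ , [] , refl)
  cons-<Z (inj₁ (via₁ step)) = via₂₁ (_ , (refl , _ , [] , refl) , step)
  cons-<Z (inj₁ (via₂ (refl , w , t , refl))) = via₂ (refl , _ , w ∷ t , refl)
  cons-<Z (inj₁ (via₃ (w , t , refl , min≤))) = via₃ (_ , w ∷ t , refl , min2-boundʳ min≤)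
  cons-<Z (inj₁ (via₂₁ (q , (refl , w , t , refl) , step))) = via₂₁ (q , (refl , _ , w ∷ t , refl) , step)
  cons-<Z (inj₁ (via₃₁ (q , (w , t , refl , min≤) , step))) = via₃₁ (q , (_ , w ∷ t , refl , min2-boundʳ min≤) , step)

  _⊑_ : List W → List W → Set
  s ⊑ s' = (∃ λ t → s ≡ t ++ s')
         ⊎ (∃ λ t → ∃ λ u → ∃ λ u' → ∃ λ r → s ≡ t ++ u ∷ r × s' ≡ u' ∷ r × u < u')

  ⊑-length : ∀ {s s'} → s ⊑ s' → length s' ℕ.≤ length s
  ⊑-length (inj₁ (t , refl)) = length-++-≤ʳ _ {t}
  ⊑-length (inj₂ (t , _ , _ , _ , refl , refl , _)) = length-++-≤ʳ _ {t}

  ⊑-not-cons : ∀ {s u} → ¬ s ⊑ (u ∷ s)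
  ⊑-not-cons s⊑us = 1+n≰n (⊑-length s⊑us)

  cons-<Z-⊑ : ∀ {m v s m' s'} → v ≤ m' → s ⊑ s' → (m , v ∷ s) <Z (m' , s')
  cons-<Z-⊑ {v = v} v≤m' (inj₁ (t , refl)) = via₃ (v , t , refl , minStr-boundHead v t v≤m')
  cons-<Z-⊑ {v = v} v≤m' (inj₂ (t , u , u' , r , refl , refl , u<u')) =
    via₃₁ (_ , (v , t , refl , minStr-boundHead v t v≤m') , (refl , u , u' , r , refl , refl , u<u'))

  data AboveCons (m u : W) (s : List W) : Z → Set where
    raise      : ∀ {u'} → u ≤ u' → AboveCons m u s (m , u' ∷ s)
    aboveTail  : ∀ {y} → (m , s) ≤Z y → AboveCons m u s y
    belowLabel : ∀ {m' s'} → u ≤ m' → s ⊑ s' → AboveCons m u s (m' , s')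

  AboveCons⇒≤Z : ∀ {m u s y} → AboveCons m u s y → (m , u ∷ s) ≤Z y
  AboveCons⇒≤Z (raise (inj₂ refl)) = inj₂ refl
  AboveCons⇒≤Z (raise (inj₁ u<u')) = inj₁ (via₁ (refl , _ , _ , _ , refl , refl , u<u'))
  AboveCons⇒≤Z (aboveTail s≤y) = inj₁ (cons-<Z s≤y)
  AboveCons⇒≤Z (belowLabel u≤m' s⊑s') = inj₁ (cons-<Z-⊑ u≤m' s⊑s')

  ≤Z⇒AboveCons : ∀ {m u s y} → (m , u ∷ s) ≤Z y → AboveCons m u s y
  ≤Z⇒AboveCons (inj₂ refl) = raise (inj₂ refl)
  ≤Z⇒AboveCons (inj₁ (via₁ (refl , _ , _ , _ , refl , refl , u<u'))) = raise (inj₁ u<u')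
  ≤Z⇒AboveCons (inj₁ (via₂ (refl , _ , [] , refl))) = aboveTail (inj₂ refl)
  ≤Z⇒AboveCons (inj₁ (via₂ (refl , _ , w ∷ t , refl))) = aboveTail (inj₁ (via₂ (refl , w , t , refl)))
  ≤Z⇒AboveCons (inj₁ (via₃ (_ , [] , refl , u≤m'))) = belowLabel u≤m' (inj₁ ([] , refl))
  ≤Z⇒AboveCons (inj₁ (via₃ (_ , w ∷ t , refl , min≤m'))) with min2-bound-cases min≤m'
  ... | inj₁ u≤m'  = belowLabel u≤m' (inj₁ (w ∷ t , refl))
  ... | inj₂ min≤m' = aboveTail (inj₁ (via₃ (w , t , refl , min≤m')))
  ≤Z⇒AboveCons (inj₁ (via₂₁ (_ , (refl , _ , [] , refl) , step))) = aboveTail (inj₁ (via₁ step))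
  ≤Z⇒AboveCons (inj₁ (via₂₁ (_ , (refl , _ , w ∷ t , refl) , step@(refl , _ , _ , _ , refl , refl , _)))) =
    aboveTail (inj₁ (via₂₁ (_ , (refl , w , t , refl) , step)))
  ≤Z⇒AboveCons (inj₁ (via₃₁ (_ , (_ , [] , refl , u≤m') , (refl , a , b , r , refl , refl , a<b)))) =
    belowLabel u≤m' (inj₂ ([] , a , b , r , refl , refl , a<b))
  ≤Z⇒AboveCons (inj₁ (via₃₁ (_ , (_ , w ∷ t , refl , min≤m') , step@(refl , a , b , r , refl , refl , a<b))))
    with min2-bound-cases min≤m'
  ... | inj₁ u≤m'  = belowLabel u≤m' (inj₂ (w ∷ t , a , b , r , refl , refl , a<b))
  ... | inj₂ min≤m' = aboveTail (inj₁ (via₃₁ (_ , (w , t , refl , min≤m') , step)))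

  cons-cone : ∀ {m u s y} → (m , u ∷ s) ≤Z y →
              ∃ λ b → (∀ {v} → v ≤ b → (m , v ∷ s) ≤Z y)
                    × (∀ {v} → (m , v ∷ s) ≤Z y → v ≤ b ⊎ (m , s) ≤Z y)
  cons-cone {m} {u} {s} {y} us≤y with ≤Z⇒AboveCons us≤y
  ... | raise {u'} _ = u' , (λ v≤u' → AboveCons⇒≤Z (raise v≤u')) , below
    where
    below : ∀ {v} → (m , v ∷ s) ≤Z (m , u' ∷ s) → v ≤ u' ⊎ (m , s) ≤Z (m , u' ∷ s)
    below vs≤y with ≤Z⇒AboveCons vs≤y
    ... | raise v≤u'         = inj₁ v≤u'
    ... | aboveTail s≤y      = inj₂ s≤y
    ... | belowLabel _ s⊑u's = ⊥-elim (⊑-not-cons s⊑u's)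
  ... | aboveTail s≤y = u , (λ _ → AboveCons⇒≤Z (aboveTail s≤y)) , λ _ → inj₂ s≤y
  ... | belowLabel {m'} _ s⊑s' = m' , (λ v≤m' → AboveCons⇒≤Z (belowLabel v≤m' s⊑s')) , below
    where
    below : ∀ {v} → (m , v ∷ s) ≤Z y → v ≤ m' ⊎ (m , s) ≤Z y
    below vs≤y with ≤Z⇒AboveCons vs≤y
    ... | raise _            = ⊥-elim (⊑-not-cons s⊑s')
    ... | aboveTail s≤y      = inj₂ s≤y
    ... | belowLabel v≤m' _  = inj₁ v≤m'

  module _ (em : ExcludedMiddle 0ℓ) where

    shortest : ∀ {D : Z → Set} → ∃ D → ∃ λ x₀ → D x₀ × (∀ {x} → D x → ¬ len x ℕ.< len x₀)
    shortest {D} (x₁ , d₁) with minimal em <-wellFounded (λ n → ∃ λ x → D x × len x ≡ n) (x₁ , d₁ , refl)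
    ... | _ , (x₀ , d₀ , refl) , noShorter = x₀ , d₀ , λ dx x<x₀ → noShorter x<x₀ (_ , dx , refl)

    module ShortestCons (D : Z → Set) (directed : ∀ x y → D x → D y → ∃[ z ] (D z × x ≤Z z × y ≤Z z))
                        {m u₀ s} (d₀ : D (m , u₀ ∷ s))
                        (noShorter : ∀ {x} → D x → ¬ len x ℕ.< len (m , u₀ ∷ s)) where

      U : W → Set
      U u = D (m , u ∷ s)

      cofinal : ∀ {x} → D x → ∃ λ u → U u × x ≤Z (m , u ∷ s)
      cofinal {x} dx with directed x _ dx d₀
      ... | _ , dz , x≤z , inj₂ refl = u₀ , dz , x≤z
      ... | _ , dz , x≤z , inj₁ x₀<z with <Z⇒<₁⊎len> x₀<z
      ...   | inj₁ (refl , _ , u , _ , refl , refl , _) = u , dz , x≤z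
      ...   | inj₂ z<x₀ = ⊥-elim (noShorter dz z<x₀)

      upperBound-cases : ∀ {y} → (∀ x → D x → x ≤Z y) →
                         (m , s) ≤Z y ⊎ ∃ λ b → UpperBound U b × (∀ {v} → v ≤ b → (m , v ∷ s) ≤Z y)
      upperBound-cases {y} ub with cons-cone (ub _ d₀) | em {(m , s) ≤Z y}
      ... | _ | yes s≤y = inj₁ s≤y
      ... | b , fromB , toB | no s≰y = inj₂ (b , bound , fromB)
        where
        bound : UpperBound U b
        bound du with toB (ub _ du)
        ... | inj₁ u≤b = u≤b
        ... | inj₂ s≤y = ⊥-elim (s≰y s≤y)

      lub-isSupremum : ∀ {σ} → UpperBound U σ → (∀ {c} → UpperBound U c → σ ≤ c) →
                       IsSupremum D (m , σ ∷ s)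
      lub-isSupremum {σ} σ-bound σ-least = upper , least
        where
        upper : ∀ x → D x → x ≤Z (m , σ ∷ s)
        upper x dx with cofinal dx
        ... | _ , du , x≤us = ≤Z-raiseHead x≤us (σ-bound du)

        least : ∀ y → (∀ x → D x → x ≤Z y) → (m , σ ∷ s) ≤Z y
        least y ub with upperBound-cases ub
        ... | inj₁ s≤y = inj₁ (cons-<Z s≤y)
        ... | inj₂ (_ , bound , fromB) = fromB (σ-least bound)

      unbounded-isSupremum : ¬ ∃ (UpperBound U) → IsSupremum D (m , s)
      unbounded-isSupremum unbounded = upper , least
        where
        upper : ∀ x → D x → x ≤Z (m , s)
        upper x dx with cofinal dx
        ... | _ , _ , x≤us = inj₁ (≤Z-dropHead x≤us)

        least : ∀ y → (∀ x → D x → x ≤Z y) → (m , s) ≤Z y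
        least y ub with upperBound-cases ub
        ... | inj₁ s≤y = s≤y
        ... | inj₂ (b , bound , _) = ⊥-elim (unbounded (b , bound))

      supremum : ∃ (IsSupremum D)
      supremum with em {∃ (UpperBound U)}
      ... | no unbounded = (m , s) , unbounded-isSupremum unbounded
      ... | yes bounded with leastUpperBound em U bounded
      ...   | σ , σ-bound , σ-least = (m , σ ∷ s) , lub-isSupremum σ-bound σ-least

    dcpo : IsDCPO
    dcpo D (inhabited , directed) with shortest inhabited
    ... | (m , []) , d₀ , _ = (m , []) , upper , λ _ ub → ub _ d₀
      where
      upper : ∀ x → D x → x ≤Z (m , [])
      upper x dx with directed x _ dx d₀
      ... | _ , _ , x≤z , inj₂ refl = x≤z
      ... | _ , _ , _   , inj₁ []<z = ⊥-elim ([]-maximal []<z)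
    ... | (m , _ ∷ _) , d₀ , noShorter = ShortestCons.supremum D directed d₀ noShorter

mainTheorem8 : (O : Omega1) → ExcludedMiddle 0ℓ → Omega1.IsDCPO O
mainTheorem8 = dcpo
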